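{- Suppose $n>1$, let $S\subseteq\mathbb{F}_2^n$ and let $s=|S|$. Then \[ \mathcal{L}(S)\ \ge\ \left(\frac{2^n(3s-2)-s^3}{2^n-s}\right)^{1/2}, \] with equality if and only if $S$ is Sidon and $\widehat{1_S}(a)\in\{0,\pm\mathcal{L}(S)\}$ for all $a\in\mathbb{F}_2^n\setminus\{0\}$.
   Context: $\widehat{1_S}(a)=\sum_{x\in S}(-1)^{x\cdot a}$ (standard dot product) is the Fourier transform of $S$, and the linearity of $S$ is $\mathcal{L}(S)=\max_{a\in\mathbb{F}_2^n\setminus\{0\}}|\widehat{1_S}(a)|$. A set $S\subseteq\mathbb{F}_2^n$ is a Sidon set if whenever $a+b=c+d$ with $a,b,c,d\in S$, $a\neq b$, $c\neq d$, then $\{a,b\}=\{c,d\}$. -}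

module Defs where

open import Data.Bool using (Bool; true; false; _xor_; _∧_; if_then_else_)
open import Data.Nat using (ℕ; zero; suc; _⊔_)
open import Data.Integer using (ℤ; +_; -_; _+_; ∣_∣)
open import Data.List using (List; []; _∷_; [_]; map; _++_; foldr; length; filter)
open import Data.Vec using (Vec; []; _∷_; zipWith; replicate)
open import Data.Product using (_×_)
open import Data.Sum using (_⊎_)
open import Relation.Binary.PropositionalEquality using (_≡_; _≢_)
open import Relation.Nullary.Decidable using (does)
open import Data.Bool.Properties using (T?)
open import Data.Vec.Properties using (≡-dec)
import Data.Bool.Properties as BP
open import Relation.Nullary using (¬?)

-- 𝔽₂ⁿ is represented as Vec Bool n (true = 1, false = 0, addition = xor).
F2^ : ℕ → Set
F2^ n = Vec Bool n

Subset2 : ℕ → Set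
Subset2 n = F2^ n → Bool

allVecs : (n : ℕ) → List (F2^ n)
allVecs zero = [ [] ]
allVecs (suc n) = map (false ∷_) (allVecs n) ++ map (true ∷_) (allVecs n)

0v : (n : ℕ) → F2^ n
0v n = replicate n false

_⊕_ : {n : ℕ} → F2^ n → F2^ n → F2^ n
_⊕_ = zipWith _xor_

dot : {n : ℕ} → F2^ n → F2^ n → Bool
dot x a = foldr _xor_ false (Data.Vec.toList (zipWith _∧_ x a))
  where import Data.Vec

nonzeroVecs : (n : ℕ) → List (F2^ n)
nonzeroVecs n = filter (λ a → ¬? (≡-dec BP._≟_ a (0v n))) (allVecs n)

elems : {n : ℕ} → Subset2 n → List (F2^ n)
elems {n} S = filter (λ x → T? (S x)) (allVecs n)

card : {n : ℕ} → Subset2 n → ℕ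
card S = length (elems S)

sgn : Bool → ℤ
sgn b = if b then - (+ 1) else + 1

fourier : {n : ℕ} → Subset2 n → F2^ n → ℤ
fourier S a = foldr (λ x acc → sgn (dot x a) + acc) (+ 0) (elems S)

linearity : {n : ℕ} → Subset2 n → ℕ
linearity {n} S = foldr (λ a m → ∣ fourier S a ∣ ⊔ m) 0 (nonzeroVecs n)

IsSidon : {n : ℕ} → Subset2 n → Set
IsSidon {n} S = (a b c d : F2^ n) → S a ≡ true → S b ≡ true → S c ≡ true → S d ≡ true →
  a ≢ b → c ≢ d → a ⊕ b ≡ c ⊕ d → (a ≡ c × b ≡ d) ⊎ (a ≡ d × b ≡ c)

{-# OPTIONS --safe #-}

-- Write F = 1̂_S, N = 2ⁿ and s = |S|.  Parseval gives Σ_{a≠0} F(a)² = Ns − s², and the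
-- fourth-moment identity gives Σ_{a≠0} F(a)⁴ = N·E − s⁴, where E is the number of solutions
-- of x + y = z + w in S.  The solutions with {x, y} = {z, w} number 3s² − 2s, so
-- E = 3s² − 2s + excess with excess ≥ 0, and excess = 0 exactly when S is Sidon.  Since
-- F(a)² ≤ L² for a ≠ 0, the deficit Σ_{a≠0} F(a)²(L² − F(a)²) is nonnegative and vanishes
-- exactly when F(a) ∈ {0, ±L} for every a ≠ 0.  Eliminating the two moments gives
--   s · (L²(N − s) − (N(3s − 2) − s³)) = N · excess + deficit,
-- and the theorem follows because s > 0.

module Submission where

open import Defs
open import Data.Bool using (Bool; true; false; not; _∧_; _xor_)
import Data.Bool.Properties as Bool
open import Data.Bool.Properties using (T?)
open import Data.Empty using (⊥-elim)
open import Data.Integer using (ℤ; +_; -_; _+_; _-_; _*_; _≤_; ∣_∣; +≤+; +<+)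
import Data.Integer as ℤ using (_<_; -[1+_])
import Data.Integer.Properties as ℤ
open import Data.Integer.Tactic.RingSolver using (solve-∀)
open import Data.List using (List; []; _∷_; map; _++_; foldr; length; filter)
open import Data.List.Membership.Propositional using (_∈_)
open import Data.List.Membership.Propositional.Properties using (∈-++⁺ˡ; ∈-++⁺ʳ; ∈-map⁺; ∈-filter⁺)
open import Data.List.Relation.Unary.All as All using (All; []; _∷_)
open import Data.List.Relation.Unary.All.Properties using (all-filter)
open import Data.List.Relation.Unary.Any using (here)
open import Data.Nat using (ℕ; suc; _<_; _^_; _⊔_)
import Data.Nat as ℕ using (_≤_; _*_; z≤n)
import Data.Nat.Properties as ℕ
open import Data.Product using (_×_; _,_)
open import Data.Product.Function.NonDependent.Propositional using (_×-⇔_)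
open import Data.Sum using (_⊎_; inj₁; inj₂; [_,_]′)
open import Data.Vec using ([]; _∷_)
open import Data.Vec.Properties
  using (≡-dec; map-id; zipWith-assoc; zipWith-comm; zipWith-identityˡ; zipWith-identityʳ; zipWith-inverseˡ)
open import Function using (_∘_; id)
open import Function.Bundles using (_⇔_; mk⇔; Equivalence)
import Function.Properties.Equivalence as ⇔
open import Relation.Binary.PropositionalEquality
  using (_≡_; _≢_; refl; sym; trans; cong; cong₂; subst; module ≡-Reasoning)
open import Relation.Nullary using (¬_; ¬?; Dec; yes; no; does)
open import Relation.Nullary.Decidable using (dec-false)
open import Relation.Binary.Definitions using (tri<; tri≈; tri>)
open import Relation.Unary using (Decidable)
open import Algebra.Bundles using (CommutativeRing)
open import Algebra.Properties.CommutativeSemigroup ℤ.*-commutativeSemigroup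
  using () renaming (interchange to *-interchange)
open import Algebra.Properties.CommutativeSemigroup
  (CommutativeRing.+-commutativeSemigroup Bool.xor-∧-commutativeRing)
  using () renaming (interchange to xor-interchange)

private
  variable
    A B : Set
    n : ℕ

+-nonneg : ∀ {i j} → + 0 ≤ i → + 0 ≤ j → + 0 ≤ i + j
+-nonneg = ℤ.+-mono-≤

*-nonneg : ∀ {i j} → + 0 ≤ i → + 0 ≤ j → + 0 ≤ i * j
*-nonneg {+ m} {+ k} _ _ = subst (+ 0 ≤_) (ℤ.pos-* m k) (+≤+ ℕ.z≤n)

nonneg-+-≡0 : ∀ {i j} → + 0 ≤ i → + 0 ≤ j → i + j ≡ + 0 → i ≡ + 0 × j ≡ + 0
nonneg-+-≡0 {+ m} {+ k} _ _ m+k≡0 =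
  cong +_ (ℕ.m+n≡0⇒m≡0 m (ℤ.+-injective m+k≡0)) , cong +_ (ℕ.m+n≡0⇒n≡0 m (ℤ.+-injective m+k≡0))

i≡j+k⇒k≡i-j : ∀ {i j k} → i ≡ j + k → k ≡ i - j
i≡j+k⇒k≡i-j {i} {j} {k} i≡j+k = trans (sym (cancel j k)) (cong (_- j) (sym i≡j+k))
  where
  cancel : ∀ j k → j + k - j ≡ k
  cancel = solve-∀

k*i≡0⇔i≡0 : ∀ {k i} → + 0 ℤ.< k → (k * i ≡ + 0 ⇔ i ≡ + 0)
k*i≡0⇔i≡0 {k} {i} 0<k = mk⇔
  (λ k*i≡0 → [ (λ k≡0 → ⊥-elim (ℤ.<-irrefl (sym k≡0) 0<k)) , id ]′
               (ℤ.i*j≡0⇒i≡0∨j≡0 k k*i≡0))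
  (λ i≡0 → trans (cong (k *_) i≡0) (ℤ.*-zeroʳ k))

0≤k*[i-j]⇒j≤i : ∀ {k i j} → + 0 ℤ.< k → + 0 ≤ k * (i - j) → j ≤ i
0≤k*[i-j]⇒j≤i {k} {i} {j} 0<k 0≤k*[i-j] = ℤ.0≤i-j⇒j≤i (ℤ.*-cancelˡ-≤-pos (+ 0) (i - j) k {{ℤ.positive 0<k}}
  (subst (_≤ k * (i - j)) (sym (ℤ.*-zeroʳ k)) 0≤k*[i-j]))

j≡i⇔k*[i-j]≡0 : ∀ {k i j} → + 0 ℤ.< k → (j ≡ i ⇔ k * (i - j) ≡ + 0)
j≡i⇔k*[i-j]≡0 {k} {i} {j} 0<k = ⇔.trans
  (mk⇔ (λ j≡i → ℤ.i≡j⇒i-j≡0 (sym j≡i)) (λ i-j≡0 → sym (ℤ.i-j≡0⇒i≡j i j i-j≡0)))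
  (⇔.sym (k*i≡0⇔i≡0 0<k))

nonneg-+-≡0⇔ : ∀ {i j} → + 0 ≤ i → + 0 ≤ j → (i + j ≡ + 0 ⇔ (i ≡ + 0 × j ≡ + 0))
nonneg-+-≡0⇔ 0≤i 0≤j = mk⇔ (nonneg-+-≡0 0≤i 0≤j) (λ { (refl , refl) → refl })

i*i≡∣i∣*∣i∣ : ∀ i → i * i ≡ + (∣ i ∣ ℕ.* ∣ i ∣)
i*i≡∣i∣*∣i∣ (+ m)       = ℤ.+◃n≡+n _
i*i≡∣i∣*∣i∣ ℤ.-[1+ m ]  = ℤ.+◃n≡+n _

m*m≡n*n⇒m≡n : ∀ m n → m ℕ.* m ≡ n ℕ.* n → m ≡ n
m*m≡n*n⇒m≡n m n m²≡n² with ℕ.<-cmp m n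
... | tri< m<n _ _ = ⊥-elim (ℕ.<⇒≢ (ℕ.*-mono-< m<n m<n) m²≡n²)
... | tri≈ _ m≡n _ = m≡n
... | tri> _ _ n<m = ⊥-elim (ℕ.<⇒≢ (ℕ.*-mono-< n<m n<m) (sym m²≡n²))

flat-term : ℤ → ℕ → ℤ
flat-term i l = i * i * (+ l * + l - i * i)

flat-term-nonneg : ∀ i l → ∣ i ∣ ℕ.≤ l → + 0 ≤ flat-term i l
flat-term-nonneg i l ∣i∣≤l rewrite i*i≡∣i∣*∣i∣ i | sym (ℤ.pos-* l l) =
  *-nonneg {+ (∣ i ∣ ℕ.* ∣ i ∣)} (+≤+ ℕ.z≤n)
           (ℤ.i≤j⇒0≤j-i (+≤+ (ℕ.*-mono-≤ ∣i∣≤l ∣i∣≤l)))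

flat-term-≡0⇔ : ∀ i l → flat-term i l ≡ + 0 ⇔ (i ≡ + 0 ⊎ i ≡ + l ⊎ i ≡ - (+ l))
flat-term-≡0⇔ i l = mk⇔ to from
  where
  ∣i∣≡l : + l * + l - i * i ≡ + 0 → ∣ i ∣ ≡ l
  ∣i∣≡l l²-i²≡0 = sym (m*m≡n*n⇒m≡n l ∣ i ∣ (ℤ.+-injective
    (trans (ℤ.pos-* l l) (trans (ℤ.i-j≡0⇒i≡j _ _ l²-i²≡0) (i*i≡∣i∣*∣i∣ i)))))
  to : flat-term i l ≡ + 0 → i ≡ + 0 ⊎ i ≡ + l ⊎ i ≡ - (+ l)
  to i²[l²-i²]≡0 with ℤ.i*j≡0⇒i≡0∨j≡0 (i * i) i²[l²-i²]≡0
  ... | inj₁ i²≡0    = inj₁ ([ id , id ]′ (ℤ.i*j≡0⇒i≡0∨j≡0 i i²≡0))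
  ... | inj₂ l²-i²≡0 with ℤ.+∣i∣≡i⊎+∣i∣≡-i i
  ...   | inj₁ +∣i∣≡i  = inj₂ (inj₁ (trans (sym +∣i∣≡i) (cong +_ (∣i∣≡l l²-i²≡0))))
  ...   | inj₂ +∣i∣≡-i = inj₂ (inj₂ (trans (sym (ℤ.neg-involutive i))
                                     (cong -_ (trans (sym +∣i∣≡-i) (cong +_ (∣i∣≡l l²-i²≡0))))))
  vanishes⁺ : ∀ j → j * j * (j * j - j * j) ≡ + 0
  vanishes⁺ = solve-∀
  vanishes⁻ : ∀ j → - j * - j * (j * j - - j * - j) ≡ + 0
  vanishes⁻ = solve-∀
  from : i ≡ + 0 ⊎ i ≡ + l ⊎ i ≡ - (+ l) → flat-term i l ≡ + 0
  from (inj₁ refl)        = refl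
  from (inj₂ (inj₁ refl)) = vanishes⁺ (+ l)
  from (inj₂ (inj₂ refl)) = vanishes⁻ (+ l)

⟦_⟧ : Bool → ℤ
⟦ true  ⟧ = + 1
⟦ false ⟧ = + 0

⟦⟧-∧ : ∀ a b → ⟦ a ∧ b ⟧ ≡ ⟦ a ⟧ * ⟦ b ⟧
⟦⟧-∧ true  true  = refl
⟦⟧-∧ true  false = refl
⟦⟧-∧ false b     = refl

⟦⟧-partition : ∀ b t → ⟦ b ⟧ * t + ⟦ not b ⟧ * t ≡ t
⟦⟧-partition true  t = trans (ℤ.+-identityʳ _) (ℤ.*-identityˡ t)
⟦⟧-partition false t = trans (ℤ.+-identityˡ _) (ℤ.*-identityˡ t)

-- ∑ is opaque so that unification compares ∑ xs f syntactically instead of unfolding it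
-- to a foldr; ∑-foldr and ∑-singleton expose the definition where it is needed.
opaque
  ∑ : List A → (A → ℤ) → ℤ
  ∑ xs f = foldr (λ x acc → f x + acc) (+ 0) xs

  ∑-cong : ∀ (xs : List A) {f g : A → ℤ} → (∀ x → f x ≡ g x) → ∑ xs f ≡ ∑ xs g
  ∑-cong []       f≗g = refl
  ∑-cong (x ∷ xs) f≗g = cong₂ _+_ (f≗g x) (∑-cong xs f≗g)

  ∑-++ : ∀ (xs ys : List A) (f : A → ℤ) → ∑ (xs ++ ys) f ≡ ∑ xs f + ∑ ys f
  ∑-++ []       ys f = sym (ℤ.+-identityˡ _)
  ∑-++ (x ∷ xs) ys f = trans (cong (λ t → f x + t) (∑-++ xs ys f)) (sym (ℤ.+-assoc (f x) _ _))

  ∑-map : ∀ (g : A → B) xs (f : B → ℤ) → ∑ (map g xs) f ≡ ∑ xs (f ∘ g)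
  ∑-map g []       f = refl
  ∑-map g (x ∷ xs) f = cong (λ t → f (g x) + t) (∑-map g xs f)

  ∑-+ : ∀ (xs : List A) (f g : A → ℤ) → ∑ xs (λ x → f x + g x) ≡ ∑ xs f + ∑ xs g
  ∑-+ []       f g = refl
  ∑-+ (x ∷ xs) f g = trans (cong (λ t → f x + g x + t) (∑-+ xs f g)) (interchange (f x) (g x) _ _)
    where
    interchange : ∀ a b c d → a + b + (c + d) ≡ a + c + (b + d)
    interchange = solve-∀

  ∑-*ˡ : ∀ (xs : List A) c (f : A → ℤ) → ∑ xs (λ x → c * f x) ≡ c * ∑ xs f
  ∑-*ˡ []       c f = sym (ℤ.*-zeroʳ c)
  ∑-*ˡ (x ∷ xs) c f = trans (cong (λ t → c * f x + t) (∑-*ˡ xs c f)) (sym (ℤ.*-distribˡ-+ c (f x) _))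

  ∑-*ʳ : ∀ (xs : List A) c (f : A → ℤ) → ∑ xs (λ x → f x * c) ≡ ∑ xs f * c
  ∑-*ʳ xs c f = trans (∑-cong xs (λ x → ℤ.*-comm (f x) c)) (trans (∑-*ˡ xs c f) (ℤ.*-comm c _))

  ∑-zero : ∀ {xs : List A} {f} → All (λ x → f x ≡ + 0) xs → ∑ xs f ≡ + 0
  ∑-zero []         = refl
  ∑-zero (fx≡0 ∷ p) = cong₂ _+_ fx≡0 (∑-zero p)

  ∑-swap : ∀ (xs : List A) (ys : List B) (f : A → B → ℤ) →
           ∑ xs (λ x → ∑ ys (f x)) ≡ ∑ ys (λ y → ∑ xs (λ x → f x y))
  ∑-swap []       ys f = sym (∑-zero (All.universal (λ _ → refl) ys))
  ∑-swap (x ∷ xs) ys f = trans (cong (λ t → ∑ ys (f x) + t) (∑-swap xs ys f)) (sym (∑-+ ys (f x) _))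

  ∑-*-∑ : ∀ (xs : List A) (ys : List B) (f : A → ℤ) (g : B → ℤ) →
          ∑ xs f * ∑ ys g ≡ ∑ xs (λ x → ∑ ys (λ y → f x * g y))
  ∑-*-∑ xs ys f g = trans (sym (∑-*ʳ xs (∑ ys g) f)) (∑-cong xs (λ x → sym (∑-*ˡ ys (f x) g)))

  ∑-swap-*ʳ : ∀ (as : List A) (xs : List B) (g : B → A → ℤ) (h : A → ℤ) →
              ∑ as (λ a → ∑ xs (λ x → g x a) * h a) ≡ ∑ xs (λ x → ∑ as (λ a → g x a * h a))
  ∑-swap-*ʳ as xs g h = trans (∑-cong as (λ a → sym (∑-*ʳ xs (h a) (λ x → g x a))))
                              (∑-swap as xs (λ a x → g x a * h a))

  ∑-singleton : ∀ (x : A) (f : A → ℤ) → ∑ (x ∷ []) f ≡ f x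
  ∑-singleton x f = ℤ.+-identityʳ (f x)

  ∑-foldr : ∀ (xs : List A) (f : A → ℤ) → ∑ xs f ≡ foldr (λ x acc → f x + acc) (+ 0) xs
  ∑-foldr xs f = refl

  ∑-filter : ∀ {P : A → Set} (P? : Decidable P) xs (f : A → ℤ) →
             ∑ (filter P? xs) f ≡ ∑ xs (λ x → ⟦ does (P? x) ⟧ * f x)
  ∑-filter P? []       f = refl
  ∑-filter P? (x ∷ xs) f with does (P? x)
  ... | true  = cong₂ _+_ (sym (ℤ.*-identityˡ (f x))) (∑-filter P? xs f)
  ... | false = trans (∑-filter P? xs f) (sym (ℤ.+-identityˡ _))

  ∑-length : ∀ (xs : List A) → + length xs ≡ ∑ xs (λ _ → + 1)
  ∑-length []       = refl
  ∑-length (x ∷ xs) = cong (λ t → + 1 + t) (∑-length xs)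

  ∑-nonneg : ∀ {xs : List A} {f} → All (λ x → + 0 ≤ f x) xs → + 0 ≤ ∑ xs f
  ∑-nonneg []       = +≤+ ℕ.z≤n
  ∑-nonneg (p ∷ ps) = +-nonneg p (∑-nonneg ps)

  ∑-nonneg-≡0 : ∀ {xs : List A} {f} → All (λ x → + 0 ≤ f x) xs → ∑ xs f ≡ + 0 →
                All (λ x → f x ≡ + 0) xs
  ∑-nonneg-≡0 []       _   = []
  ∑-nonneg-≡0 (p ∷ ps) ∑≡0 with nonneg-+-≡0 p (∑-nonneg ps) ∑≡0
  ... | fx≡0 , ∑xs≡0 = fx≡0 ∷ ∑-nonneg-≡0 ps ∑xs≡0

≤-foldr-⊔ : ∀ (h : A → ℕ) xs → All (λ x → h x ℕ.≤ foldr (λ y m → h y ⊔ m) 0 xs) xs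
≤-foldr-⊔ h []       = []
≤-foldr-⊔ h (x ∷ xs) =
  ℕ.m≤m⊔n (h x) _ ∷ All.map (λ hy≤max → ℕ.≤-trans hy≤max (ℕ.m≤n⊔m (h x) _))
                            (≤-foldr-⊔ h xs)

-- The group 𝔽₂ⁿ

_≟_ : (x y : F2^ n) → Dec (x ≡ y)
_≟_ = ≡-dec Bool._≟_

δ δᶜ : F2^ n → F2^ n → ℤ
δ  y x = ⟦ does (y ≟ x) ⟧
δᶜ y x = ⟦ not (does (y ≟ x)) ⟧

δᶜ-cong : ∀ {y x : F2^ n} {i j} → (y ≢ x → i ≡ j) → δᶜ y x * i ≡ δᶜ y x * j
δᶜ-cong {y = y} {x} i≡j with y ≟ x
... | yes _   = refl
... | no  y≢x = cong (+ 1 *_) (i≡j y≢x)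

δᶜ-≢ : ∀ {y x : F2^ n} → y ≢ x → δᶜ y x ≡ + 1
δᶜ-≢ {y = y} {x} y≢x = cong (⟦_⟧ ∘ not) (dec-false (y ≟ x) y≢x)

⊕-assoc : ∀ (x y z : F2^ n) → (x ⊕ y) ⊕ z ≡ x ⊕ (y ⊕ z)
⊕-assoc = zipWith-assoc Bool.xor-assoc

⊕-comm : ∀ (x y : F2^ n) → x ⊕ y ≡ y ⊕ x
⊕-comm = zipWith-comm Bool.xor-comm

⊕-identityˡ : ∀ (x : F2^ n) → 0v n ⊕ x ≡ x
⊕-identityˡ = zipWith-identityˡ Bool.xor-identityˡ

⊕-identityʳ : ∀ (x : F2^ n) → x ⊕ 0v n ≡ x
⊕-identityʳ = zipWith-identityʳ Bool.xor-identityʳ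

⊕-self : ∀ (x : F2^ n) → x ⊕ x ≡ 0v n
⊕-self x = trans (cong (_⊕ x) (sym (map-id x))) (zipWith-inverseˡ Bool.xor-same x)

⊕-involutive : ∀ (x y : F2^ n) → x ⊕ (x ⊕ y) ≡ y
⊕-involutive x y = trans (sym (⊕-assoc x x y)) (trans (cong (_⊕ y) (⊕-self x)) (⊕-identityˡ y))

⊕≡0⇒≡ : ∀ {x y : F2^ n} → x ⊕ y ≡ 0v n → x ≡ y
⊕≡0⇒≡ {x = x} {y} x⊕y≡0 =
  sym (trans (sym (⊕-involutive x y)) (trans (cong (x ⊕_) x⊕y≡0) (⊕-identityʳ x)))

a⊕b≡c⊕d⇒d≡c⊕[a⊕b] : ∀ {a b c d : F2^ n} → a ⊕ b ≡ c ⊕ d → d ≡ c ⊕ (a ⊕ b)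
a⊕b≡c⊕d⇒d≡c⊕[a⊕b] {c = c} {d} a⊕b≡c⊕d =
  trans (sym (⊕-involutive c d)) (cong (c ⊕_) (sym a⊕b≡c⊕d))

∑ᵛ : (F2^ n → ℤ) → ℤ
∑ᵛ = ∑ (allVecs _)

-- ∑[ x ] binds tighter than _+_ and looser than _*_: ∑[ x ] f x * g x + c is
-- (∑[ x ] (f x * g x)) + c, and a sum used as right operand of _*_ needs parentheses.
infix 6.5 ∑ᵛ
syntax ∑ᵛ (λ x → e) = ∑[ x ] e

∈-allVecs : ∀ (x : F2^ n) → x ∈ allVecs n
∈-allVecs []                = here refl
∈-allVecs         (false ∷ x) = ∈-++⁺ˡ (∈-map⁺ (false ∷_) (∈-allVecs x))
∈-allVecs {suc n} (true ∷ x)  = ∈-++⁺ʳ (map (false ∷_) (allVecs n)) (∈-map⁺ (true ∷_) (∈-allVecs x))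

∑ᵛ-zero : ∀ {f : F2^ n → ℤ} → (∀ x → f x ≡ + 0) → ∑ᵛ f ≡ + 0
∑ᵛ-zero f≡0 = ∑-zero (All.universal f≡0 _)

∑ᵛ-nonneg : ∀ {f : F2^ n → ℤ} → (∀ x → + 0 ≤ f x) → + 0 ≤ ∑ᵛ f
∑ᵛ-nonneg 0≤f = ∑-nonneg (All.universal 0≤f _)

∑ᵛ-nonneg-≡0 : ∀ {f : F2^ n → ℤ} → (∀ x → + 0 ≤ f x) → ∑ᵛ f ≡ + 0 → ∀ x → f x ≡ + 0
∑ᵛ-nonneg-≡0 0≤f ∑≡0 x = All.lookup (∑-nonneg-≡0 (All.universal 0≤f _) ∑≡0) (∈-allVecs x)

∑ᵛ-suc : ∀ (f : F2^ (suc n) → ℤ) → ∑[ x ] f x ≡ ∑[ x ] f (false ∷ x) + ∑[ x ] f (true ∷ x)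
∑ᵛ-suc {n} f = trans (∑-++ (map (false ∷_) (allVecs n)) _ f)
                     (cong₂ _+_ (∑-map (false ∷_) (allVecs n) f) (∑-map (true ∷_) (allVecs n) f))

∑ᵛ-δ : ∀ (x : F2^ n) (f : F2^ n → ℤ) → ∑[ y ] δ y x * f y ≡ f x
∑ᵛ-δ []          f = trans (∑-singleton [] _) (ℤ.*-identityˡ (f []))
∑ᵛ-δ (false ∷ x) f = begin
  ∑[ y ] δ y (false ∷ x) * f y                ≡⟨ ∑ᵛ-suc _ ⟩
  ∑[ y ] δ y x * f (false ∷ y) + ∑[ y ] + 0    ≡⟨ cong₂ _+_ (∑ᵛ-δ x _) (∑ᵛ-zero (λ _ → refl)) ⟩
  f (false ∷ x) + + 0                        ≡⟨ ℤ.+-identityʳ _ ⟩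
  f (false ∷ x)                              ∎
  where open ≡-Reasoning
∑ᵛ-δ (true ∷ x)  f = begin
  ∑[ y ] δ y (true ∷ x) * f y                 ≡⟨ ∑ᵛ-suc _ ⟩
  ∑[ y ] + 0 + ∑[ y ] δ y x * f (true ∷ y)     ≡⟨ cong₂ _+_ (∑ᵛ-zero (λ _ → refl)) (∑ᵛ-δ x _) ⟩
  + 0 + f (true ∷ x)                         ≡⟨ ℤ.+-identityˡ _ ⟩
  f (true ∷ x)                               ∎
  where open ≡-Reasoning

∑ᵛ-split : ∀ (x : F2^ n) (f : F2^ n → ℤ) → ∑[ y ] f y ≡ f x + ∑[ y ] δᶜ y x * f y
∑ᵛ-split x f = begin
  ∑[ y ] f y
    ≡⟨ ∑-cong _ (λ y → sym (⟦⟧-partition (does (y ≟ x)) (f y))) ⟩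
  ∑[ y ] (δ y x * f y + δᶜ y x * f y)
    ≡⟨ ∑-+ _ _ _ ⟩
  ∑[ y ] δ y x * f y + ∑[ y ] δᶜ y x * f y
    ≡⟨ cong (λ t → t + ∑[ y ] δᶜ y x * f y) (∑ᵛ-δ x f) ⟩
  f x + ∑[ y ] δᶜ y x * f y ∎
  where open ≡-Reasoning

∑ᵛ-nonzero : ∀ (f : F2^ n → ℤ) → ∑[ a ] f a ≡ f (0v n) + ∑ (nonzeroVecs n) f
∑ᵛ-nonzero {n} f = trans (∑ᵛ-split (0v n) f)
  (cong (λ t → f (0v n) + t) (sym (∑-filter (λ a → ¬? (a ≟ 0v n)) (allVecs n) f)))

module _ {f : F2^ n → F2^ n → F2^ n → ℤ} where

  ∑³-nonneg : (∀ x y z → + 0 ≤ f x y z) → + 0 ≤ ∑[ x ] ∑[ y ] ∑[ z ] f x y z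
  ∑³-nonneg 0≤f = ∑ᵛ-nonneg (λ x → ∑ᵛ-nonneg (λ y → ∑ᵛ-nonneg (0≤f x y)))

  ∑³-zero : (∀ x y z → f x y z ≡ + 0) → ∑[ x ] ∑[ y ] ∑[ z ] f x y z ≡ + 0
  ∑³-zero f≡0 = ∑ᵛ-zero (λ x → ∑ᵛ-zero (λ y → ∑ᵛ-zero (f≡0 x y)))

  ∑³-nonneg-≡0 : (∀ x y z → + 0 ≤ f x y z) → ∑[ x ] ∑[ y ] ∑[ z ] f x y z ≡ + 0 →
                 ∀ x y z → f x y z ≡ + 0
  ∑³-nonneg-≡0 0≤f ∑≡0 x y =
    ∑ᵛ-nonneg-≡0 (0≤f x y) (∑ᵛ-nonneg-≡0 (0≤∑ x) (∑ᵛ-nonneg-≡0 0≤∑∑ ∑≡0 x) y)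
    where
    0≤∑ : ∀ x y → + 0 ≤ ∑[ z ] f x y z
    0≤∑ x y = ∑ᵛ-nonneg (0≤f x y)
    0≤∑∑ : ∀ x → + 0 ≤ ∑[ y ] ∑[ z ] f x y z
    0≤∑∑ x = ∑ᵛ-nonneg (0≤∑ x)

-- Characters and the Fourier transform

χ : F2^ n → F2^ n → ℤ
χ a x = sgn (dot x a)

sgn-xor : ∀ p q → sgn (p xor q) ≡ sgn p * sgn q
sgn-xor false false = refl
sgn-xor false true  = refl
sgn-xor true  false = refl
sgn-xor true  true  = refl

χ-∷ : ∀ d b (a x : F2^ n) → χ (d ∷ a) (b ∷ x) ≡ sgn (b ∧ d) * χ a x
χ-∷ d b a x = sgn-xor (b ∧ d) (dot x a)

dot-⊕ : ∀ (x y a : F2^ n) → dot (x ⊕ y) a ≡ dot x a xor dot y a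
dot-⊕ []      []      []      = refl
dot-⊕ (b ∷ x) (c ∷ y) (d ∷ a) = trans
  (cong₂ _xor_ (Bool.∧-distribʳ-xor d b c) (dot-⊕ x y a))
  (xor-interchange (b ∧ d) (c ∧ d) (dot x a) (dot y a))

dot-zeroʳ : ∀ (x : F2^ n) → dot x (0v n) ≡ false
dot-zeroʳ []      = refl
dot-zeroʳ (b ∷ x) = cong₂ _xor_ (Bool.∧-zeroʳ b) (dot-zeroʳ x)

χ-⊕ : ∀ (a x y : F2^ n) → χ a (x ⊕ y) ≡ χ a x * χ a y
χ-⊕ a x y = trans (cong sgn (dot-⊕ x y a)) (sgn-xor (dot x a) (dot y a))

χ-zero : ∀ (x : F2^ n) → χ (0v n) x ≡ + 1
χ-zero x = cong sgn (dot-zeroʳ x)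

bit-orthogonality : ∀ b c →
  sgn (b ∧ false) * sgn (c ∧ false) + sgn (b ∧ true) * sgn (c ∧ true) ≡ + 2 * ⟦ does (b Bool.≟ c) ⟧
bit-orthogonality false false = refl
bit-orthogonality false true  = refl
bit-orthogonality true  false = refl
bit-orthogonality true  true  = refl

orthogonality : ∀ (x y : F2^ n) → ∑[ a ] χ a x * χ a y ≡ + (2 ^ n) * δ x y
orthogonality []      []      = ∑-singleton [] _
orthogonality {suc n} (b ∷ x) (c ∷ y) = begin
  ∑[ a ] χ a (b ∷ x) * χ a (c ∷ y)
    ≡⟨ ∑ᵛ-suc (λ a → χ a (b ∷ x) * χ a (c ∷ y)) ⟩
  ∑[ a ] χ (false ∷ a) (b ∷ x) * χ (false ∷ a) (c ∷ y) +
  ∑[ a ] χ (true ∷ a) (b ∷ x) * χ (true ∷ a) (c ∷ y)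
    ≡⟨ cong₂ _+_ (half false) (half true) ⟩
  σ false * M + σ true * M
    ≡⟨ sym (ℤ.*-distribʳ-+ M (σ false) (σ true)) ⟩
  (σ false + σ true) * M
    ≡⟨ cong (_* M) (bit-orthogonality b c) ⟩
  + 2 * ⟦ does (b Bool.≟ c) ⟧ * (+ (2 ^ n) * δ x y)
    ≡⟨ regroup (+ 2) (⟦ does (b Bool.≟ c) ⟧) (+ (2 ^ n)) (δ x y) ⟩
  + 2 * + (2 ^ n) * (⟦ does (b Bool.≟ c) ⟧ * δ x y)
    ≡⟨ cong₂ _*_ (sym (ℤ.pos-* 2 (2 ^ n))) (sym (⟦⟧-∧ (does (b Bool.≟ c)) (does (x ≟ y)))) ⟩
  + (2 ^ suc n) * δ (b ∷ x) (c ∷ y)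
    ∎
  where
  open ≡-Reasoning
  M : ℤ
  M = + (2 ^ n) * δ x y
  σ : Bool → ℤ
  σ d = sgn (b ∧ d) * sgn (c ∧ d)
  half : ∀ d → ∑[ a ] χ (d ∷ a) (b ∷ x) * χ (d ∷ a) (c ∷ y) ≡ σ d * M
  half d = begin
    ∑[ a ] χ (d ∷ a) (b ∷ x) * χ (d ∷ a) (c ∷ y)
      ≡⟨ ∑-cong _ (λ a → cong₂ _*_ (χ-∷ d b a x) (χ-∷ d c a y)) ⟩
    ∑[ a ] (sgn (b ∧ d) * χ a x) * (sgn (c ∧ d) * χ a y)
      ≡⟨ ∑-cong _ (λ a → *-interchange (sgn (b ∧ d)) (χ a x) (sgn (c ∧ d)) (χ a y)) ⟩
    ∑[ a ] σ d * (χ a x * χ a y)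
      ≡⟨ ∑-*ˡ _ (σ d) _ ⟩
    σ d * (∑[ a ] χ a x * χ a y)
      ≡⟨ cong (σ d *_) (orthogonality x y) ⟩
    σ d * M ∎
  regroup : ∀ p i N d → p * i * (N * d) ≡ p * N * (i * d)
  regroup = solve-∀

transform : (F2^ n → ℤ) → F2^ n → ℤ
transform f a = ∑[ x ] f x * χ a x

inversion : ∀ (f : F2^ n → ℤ) v → ∑[ a ] χ a v * transform f a ≡ + (2 ^ n) * f v
inversion {n} f v = begin
  ∑[ a ] χ a v * transform f a
    ≡⟨ ∑-cong _ (λ a → sym (∑-*ˡ _ (χ a v) _)) ⟩
  ∑[ a ] ∑[ x ] χ a v * (f x * χ a x)
    ≡⟨ ∑-swap _ _ _ ⟩
  ∑[ x ] ∑[ a ] χ a v * (f x * χ a x)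
    ≡⟨ ∑-cong _ (λ x → trans (∑-cong _ (λ a → rearrange (χ a v) (f x) (χ a x))) (∑-*ˡ _ (f x) _)) ⟩
  ∑[ x ] f x * (∑[ a ] χ a x * χ a v)
    ≡⟨ ∑-cong _ (λ x → cong (f x *_) (orthogonality x v)) ⟩
  ∑[ x ] f x * (+ (2 ^ n) * δ x v)
    ≡⟨ ∑-cong _ (λ x → swap (f x) (+ (2 ^ n)) (δ x v)) ⟩
  ∑[ x ] δ x v * (+ (2 ^ n) * f x)
    ≡⟨ ∑ᵛ-δ v _ ⟩
  + (2 ^ n) * f v ∎
  where
  open ≡-Reasoning
  rearrange : ∀ c u d → c * (u * d) ≡ u * (d * c)
  rearrange = solve-∀
  swap : ∀ u N d → u * (N * d) ≡ d * (N * u)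
  swap = solve-∀

scaled-inversion : ∀ (f : F2^ n → ℤ) c v → ∑[ a ] c * χ a v * transform f a ≡ c * (+ (2 ^ n) * f v)
scaled-inversion f c v =
  trans (∑-cong _ (λ a → ℤ.*-assoc c (χ a v) _)) (trans (∑-*ˡ _ c _) (cong (c *_) (inversion f v)))

parseval : ∀ (f : F2^ n → ℤ) → ∑[ a ] transform f a * transform f a ≡ + (2 ^ n) * (∑[ x ] f x * f x)
parseval {n} f = begin
  ∑[ a ] transform f a * transform f a
    ≡⟨ ∑-swap-*ʳ _ _ (λ x a → f x * χ a x) (transform f) ⟩
  ∑[ x ] ∑[ a ] f x * χ a x * transform f a
    ≡⟨ ∑-cong _ (λ x → trans (scaled-inversion f (f x) x) (swap (f x) (+ (2 ^ n)))) ⟩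
  ∑[ x ] + (2 ^ n) * (f x * f x)
    ≡⟨ ∑-*ˡ _ (+ (2 ^ n)) _ ⟩
  + (2 ^ n) * (∑[ x ] f x * f x) ∎
  where
  open ≡-Reasoning
  swap : ∀ u N → u * (N * u) ≡ N * (u * u)
  swap = solve-∀

transform-cube : ∀ (f : F2^ n → ℤ) a → transform f a * (transform f a * transform f a) ≡
                 ∑[ x ] ∑[ y ] ∑[ z ] f x * f y * f z * χ a (z ⊕ (x ⊕ y))
transform-cube f a = begin
  T * (T * T)
    ≡⟨ cong (T *_) (∑-*-∑ _ _ _ _) ⟩
  T * (∑[ y ] ∑[ z ] f y * χ a y * (f z * χ a z))
    ≡⟨ ∑-*-∑ _ _ _ _ ⟩
  ∑[ x ] ∑[ y ] f x * χ a x * (∑[ z ] f y * χ a y * (f z * χ a z))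
    ≡⟨ ∑-cong _ (λ x → ∑-cong _ (λ y → sym (∑-*ˡ _ (f x * χ a x) _))) ⟩
  ∑[ x ] ∑[ y ] ∑[ z ] f x * χ a x * (f y * χ a y * (f z * χ a z))
    ≡⟨ ∑-cong _ (λ x → ∑-cong _ (λ y → ∑-cong _ (λ z → term x y z))) ⟩
  ∑[ x ] ∑[ y ] ∑[ z ] f x * f y * f z * χ a (z ⊕ (x ⊕ y)) ∎
  where
  open ≡-Reasoning
  T : ℤ
  T = transform f a
  regroup : ∀ u v w p q r → u * p * (v * q * (w * r)) ≡ u * v * w * (r * (p * q))
  regroup = solve-∀
  term : ∀ x y z → f x * χ a x * (f y * χ a y * (f z * χ a z)) ≡ f x * f y * f z * χ a (z ⊕ (x ⊕ y))
  term x y z = trans (regroup (f x) (f y) (f z) (χ a x) (χ a y) (χ a z))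
    (cong (f x * f y * f z *_) (sym (trans (χ-⊕ a z (x ⊕ y)) (cong (χ a z *_) (χ-⊕ a x y)))))

fourth-moment : ∀ (f : F2^ n → ℤ) →
  ∑[ a ] transform f a * (transform f a * transform f a) * transform f a ≡
  + (2 ^ n) * (∑[ x ] ∑[ y ] ∑[ z ] f x * f y * f z * f (z ⊕ (x ⊕ y)))
fourth-moment {n} f = begin
  ∑[ a ] T a * (T a * T a) * T a
    ≡⟨ ∑-cong _ (λ a → cong (_* T a) (transform-cube f a)) ⟩
  ∑[ a ] (∑[ x ] ∑[ y ] ∑[ z ] c x y z * χ a (z ⊕ (x ⊕ y))) * T a
    ≡⟨ ∑-swap-*ʳ _ _ _ T ⟩
  ∑[ x ] ∑[ a ] (∑[ y ] ∑[ z ] c x y z * χ a (z ⊕ (x ⊕ y))) * T a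
    ≡⟨ ∑-cong _ (λ x → ∑-swap-*ʳ _ _ _ T) ⟩
  ∑[ x ] ∑[ y ] ∑[ a ] (∑[ z ] c x y z * χ a (z ⊕ (x ⊕ y))) * T a
    ≡⟨ ∑-cong _ (λ x → ∑-cong _ (λ y → ∑-swap-*ʳ _ _ _ T)) ⟩
  ∑[ x ] ∑[ y ] ∑[ z ] ∑[ a ] c x y z * χ a (z ⊕ (x ⊕ y)) * T a
    ≡⟨ ∑-cong _ (λ x → ∑-cong _ (λ y → ∑-cong _ (λ z →
         trans (scaled-inversion f (c x y z) (z ⊕ (x ⊕ y))) (swap (c x y z) N _)))) ⟩
  ∑[ x ] ∑[ y ] ∑[ z ] N * (c x y z * f (z ⊕ (x ⊕ y)))
    ≡⟨ ∑-cong _ (λ x → trans (∑-cong _ (λ y → ∑-*ˡ _ N _)) (∑-*ˡ _ N _)) ⟩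
  ∑[ x ] N * (∑[ y ] ∑[ z ] c x y z * f (z ⊕ (x ⊕ y)))
    ≡⟨ ∑-*ˡ _ N _ ⟩
  N * (∑[ x ] ∑[ y ] ∑[ z ] c x y z * f (z ⊕ (x ⊕ y))) ∎
  where
  open ≡-Reasoning
  T : F2^ n → ℤ
  T = transform f
  N : ℤ
  N = + (2 ^ n)
  c : F2^ n → F2^ n → F2^ n → ℤ
  c x y z = f x * f y * f z
  swap : ∀ u N w → u * (N * w) ≡ N * (u * w)
  swap = solve-∀

-- Spectrum and additive energy of a set

module Spectrum {n : ℕ} (S : Subset2 n) where

  open ≡-Reasoning

  𝟙 : F2^ n → ℤ
  𝟙 x = ⟦ S x ⟧

  N s L : ℤ
  N = + (2 ^ n)
  s = + card S
  L = + linearity S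

  𝟙-idem : ∀ x → 𝟙 x * 𝟙 x ≡ 𝟙 x
  𝟙-idem x with S x
  ... | true  = refl
  ... | false = refl

  𝟙-pair-idem : ∀ x y → 𝟙 x * 𝟙 y * (𝟙 x * 𝟙 y) ≡ 𝟙 x * 𝟙 y
  𝟙-pair-idem x y = trans (*-interchange (𝟙 x) (𝟙 y) (𝟙 x) (𝟙 y)) (cong₂ _*_ (𝟙-idem x) (𝟙-idem y))

  ∑-elems : ∀ (f : F2^ n → ℤ) → ∑ (elems S) f ≡ ∑[ x ] 𝟙 x * f x
  ∑-elems = ∑-filter (λ x → T? (S x)) (allVecs n)

  s≡∑𝟙 : s ≡ ∑[ x ] 𝟙 x
  s≡∑𝟙 = trans (∑-length (elems S)) (trans (∑-elems _) (∑-cong _ (λ x → ℤ.*-identityʳ (𝟙 x))))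

  fourier≡transform : ∀ a → fourier S a ≡ transform 𝟙 a
  fourier≡transform a = trans (sym (∑-foldr (elems S) (χ a))) (∑-elems (χ a))

  fourier-zero : fourier S (0v n) ≡ s
  fourier-zero = begin
    fourier S (0v n)
      ≡⟨ fourier≡transform (0v n) ⟩
    ∑[ x ] 𝟙 x * χ (0v n) x
      ≡⟨ ∑-cong _ (λ x → trans (cong (𝟙 x *_) (χ-zero x)) (ℤ.*-identityʳ (𝟙 x))) ⟩
    ∑[ x ] 𝟙 x
      ≡⟨ sym s≡∑𝟙 ⟩
    s ∎

  ∑-fourier-nonzero : ∀ (g : ℤ → ℤ) →
                      g s + ∑ (nonzeroVecs n) (g ∘ fourier S) ≡ ∑[ a ] g (fourier S a)
  ∑-fourier-nonzero g =
    trans (cong (λ t → g t + ∑ (nonzeroVecs n) (g ∘ fourier S)) (sym fourier-zero)) (sym (∑ᵛ-nonzero _))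

  sum-of-squares : ∑[ a ] fourier S a * fourier S a ≡ N * s
  sum-of-squares = begin
    ∑[ a ] fourier S a * fourier S a
      ≡⟨ ∑-cong _ (λ a → cong₂ _*_ (fourier≡transform a) (fourier≡transform a)) ⟩
    ∑[ a ] transform 𝟙 a * transform 𝟙 a
      ≡⟨ parseval 𝟙 ⟩
    N * (∑[ x ] 𝟙 x * 𝟙 x)
      ≡⟨ cong (N *_) (trans (∑-cong _ 𝟙-idem) (sym s≡∑𝟙)) ⟩
    N * s ∎

  -- quad x y z = 1 iff x, y, z and w = z + x + y lie in S, i.e. iff (x, y, z, w) solves
  -- x + y = z + w in S; every solution arises this way from exactly one triple.
  quad : F2^ n → F2^ n → F2^ n → ℤ
  quad x y z = 𝟙 x * 𝟙 y * 𝟙 z * 𝟙 (z ⊕ (x ⊕ y))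

  energy : ℤ
  energy = ∑[ x ] ∑[ y ] ∑[ z ] quad x y z

  sum-of-fourth-powers : ∑[ a ] fourier S a * (fourier S a * fourier S a) * fourier S a ≡ N * energy
  sum-of-fourth-powers =
    trans (∑-cong _ (λ a → cong (λ t → t * (t * t) * t) (fourier≡transform a))) (fourth-moment 𝟙)

  excessTerm : F2^ n → F2^ n → F2^ n → ℤ
  excessTerm x y z = δᶜ y x * (δᶜ z y * (δᶜ z x * quad x y z))

  excess : ℤ
  excess = ∑[ x ] ∑[ y ] ∑[ z ] excessTerm x y z

  quad-diag : ∀ x z → quad x x z ≡ 𝟙 x * 𝟙 z
  quad-diag x z = begin
    𝟙 x * 𝟙 x * 𝟙 z * 𝟙 (z ⊕ (x ⊕ x))
      ≡⟨ cong (λ w → 𝟙 x * 𝟙 x * 𝟙 z * 𝟙 w) (trans (cong (z ⊕_) (⊕-self x)) (⊕-identityʳ z)) ⟩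
    𝟙 x * 𝟙 x * 𝟙 z * 𝟙 z             ≡⟨ regroup (𝟙 x) (𝟙 z) ⟩
    𝟙 x * 𝟙 z * (𝟙 x * 𝟙 z)           ≡⟨ 𝟙-pair-idem x z ⟩
    𝟙 x * 𝟙 z                         ∎
    where
    regroup : ∀ a b → a * a * b * b ≡ a * b * (a * b)
    regroup = solve-∀

  quad-first : ∀ x y → quad x y x ≡ 𝟙 x * 𝟙 y
  quad-first x y = begin
    𝟙 x * 𝟙 y * 𝟙 x * 𝟙 (x ⊕ (x ⊕ y))
      ≡⟨ cong (λ w → 𝟙 x * 𝟙 y * 𝟙 x * 𝟙 w) (⊕-involutive x y) ⟩
    𝟙 x * 𝟙 y * 𝟙 x * 𝟙 y             ≡⟨ regroup (𝟙 x) (𝟙 y) ⟩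
    𝟙 x * 𝟙 y * (𝟙 x * 𝟙 y)           ≡⟨ 𝟙-pair-idem x y ⟩
    𝟙 x * 𝟙 y                         ∎
    where
    regroup : ∀ a b → a * b * a * b ≡ a * b * (a * b)
    regroup = solve-∀

  quad-second : ∀ x y → quad x y y ≡ 𝟙 x * 𝟙 y
  quad-second x y = begin
    𝟙 x * 𝟙 y * 𝟙 y * 𝟙 (y ⊕ (x ⊕ y))
      ≡⟨ cong (λ w → 𝟙 x * 𝟙 y * 𝟙 y * 𝟙 w) (trans (cong (y ⊕_) (⊕-comm x y)) (⊕-involutive y x)) ⟩
    𝟙 x * 𝟙 y * 𝟙 y * 𝟙 x             ≡⟨ regroup (𝟙 x) (𝟙 y) ⟩
    𝟙 x * 𝟙 y * (𝟙 x * 𝟙 y)           ≡⟨ 𝟙-pair-idem x y ⟩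
    𝟙 x * 𝟙 y                         ∎
    where
    regroup : ∀ a b → a * b * b * a ≡ a * b * (a * b)
    regroup = solve-∀

  column-sum-diag : ∀ x → ∑[ z ] quad x x z ≡ 𝟙 x * s
  column-sum-diag x =
    trans (∑-cong _ (quad-diag x)) (trans (∑-*ˡ _ (𝟙 x) 𝟙) (cong (𝟙 x *_) (sym s≡∑𝟙)))

  column-sum-offdiag : ∀ {x y} → y ≢ x →
    ∑[ z ] quad x y z ≡ + 2 * (𝟙 x * 𝟙 y) + ∑[ z ] δᶜ z y * (δᶜ z x * quad x y z)
  column-sum-offdiag {x} {y} y≢x = begin
    ∑[ z ] quad x y z
      ≡⟨ ∑ᵛ-split x _ ⟩
    quad x y x + ∑[ z ] δᶜ z x * quad x y z
      ≡⟨ cong (λ t → quad x y x + t) (∑ᵛ-split y _) ⟩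
    quad x y x + (δᶜ y x * quad x y y + R)
      ≡⟨ cong (λ t → quad x y x + (t * quad x y y + R)) (δᶜ-≢ y≢x) ⟩
    quad x y x + (+ 1 * quad x y y + R)
      ≡⟨ cong₂ (λ u v → u + (v + R)) (quad-first x y) (trans (ℤ.*-identityˡ _) (quad-second x y)) ⟩
    𝟙 x * 𝟙 y + (𝟙 x * 𝟙 y + R)
      ≡⟨ double (𝟙 x * 𝟙 y) R ⟩
    + 2 * (𝟙 x * 𝟙 y) + R ∎
    where
    R : ℤ
    R = ∑[ z ] δᶜ z y * (δᶜ z x * quad x y z)
    double : ∀ a r → a + (a + r) ≡ + 2 * a + r
    double = solve-∀

  distinct-pairs : ∑[ x ] ∑[ y ] δᶜ y x * (𝟙 x * 𝟙 y) ≡ s * s - s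
  distinct-pairs = i≡j+k⇒k≡i-j (begin
    s * s                                      ≡⟨ cong₂ _*_ s≡∑𝟙 s≡∑𝟙 ⟩
    (∑[ x ] 𝟙 x) * (∑[ y ] 𝟙 y)                ≡⟨ ∑-*-∑ _ _ 𝟙 𝟙 ⟩
    ∑[ x ] ∑[ y ] 𝟙 x * 𝟙 y                    ≡⟨ ∑-cong _ (λ x → ∑ᵛ-split x _) ⟩
    ∑[ x ] (𝟙 x * 𝟙 x + ∑[ y ] D x y)          ≡⟨ ∑-+ _ _ _ ⟩
    ∑[ x ] 𝟙 x * 𝟙 x + ∑[ x ] ∑[ y ] D x y
      ≡⟨ cong (_+ ∑ᵛ (∑ᵛ ∘ D)) (trans (∑-cong _ 𝟙-idem) (sym s≡∑𝟙)) ⟩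
    s + ∑[ x ] ∑[ y ] D x y                    ∎)
    where
    D : F2^ n → F2^ n → ℤ
    D x y = δᶜ y x * (𝟙 x * 𝟙 y)

  row-sum : ∀ x → ∑[ y ] ∑[ z ] quad x y z ≡
    𝟙 x * s + (+ 2 * (∑[ y ] δᶜ y x * (𝟙 x * 𝟙 y)) + ∑[ y ] ∑[ z ] excessTerm x y z)
  row-sum x = begin
    ∑[ y ] ∑[ z ] quad x y z
      ≡⟨ ∑ᵛ-split x _ ⟩
    ∑[ z ] quad x x z + ∑[ y ] δᶜ y x * (∑[ z ] quad x y z)
      ≡⟨ cong₂ _+_ (column-sum-diag x) (∑-cong _ off-diagonal) ⟩
    𝟙 x * s + ∑[ y ] (+ 2 * D y + E y)
      ≡⟨ cong (λ t → 𝟙 x * s + t) (∑-+ _ (λ y → + 2 * D y) E) ⟩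
    𝟙 x * s + (∑[ y ] + 2 * D y + ∑ᵛ E)
      ≡⟨ cong (λ t → 𝟙 x * s + (t + ∑ᵛ E)) (∑-*ˡ _ (+ 2) D) ⟩
    𝟙 x * s + (+ 2 * ∑ᵛ D + ∑ᵛ E) ∎
    where
    D E : F2^ n → ℤ
    D y = δᶜ y x * (𝟙 x * 𝟙 y)
    E y = ∑[ z ] excessTerm x y z
    distribute : ∀ d a r → d * (+ 2 * a + r) ≡ + 2 * (d * a) + d * r
    distribute = solve-∀
    off-diagonal : ∀ y → δᶜ y x * (∑[ z ] quad x y z) ≡ + 2 * D y + E y
    off-diagonal y = begin
      δᶜ y x * (∑[ z ] quad x y z)
        ≡⟨ δᶜ-cong {y = y} {x} column-sum-offdiag ⟩
      δᶜ y x * (+ 2 * (𝟙 x * 𝟙 y) + ∑[ z ] δᶜ z y * (δᶜ z x * quad x y z))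
        ≡⟨ distribute (δᶜ y x) _ _ ⟩
      + 2 * D y + δᶜ y x * (∑[ z ] δᶜ z y * (δᶜ z x * quad x y z))
        ≡⟨ cong (λ t → + 2 * D y + t) (sym (∑-*ˡ _ (δᶜ y x) _)) ⟩
      + 2 * D y + E y ∎

  energy-decomposition : energy ≡ s * s + + 2 * (s * s - s) + excess
  energy-decomposition = begin
    energy
      ≡⟨ ∑-cong _ row-sum ⟩
    ∑[ x ] (𝟙 x * s + (pairRow x + excessRow x))
      ≡⟨ ∑-+ _ (λ x → 𝟙 x * s) (λ x → pairRow x + excessRow x) ⟩
    ∑[ x ] 𝟙 x * s + ∑[ x ] (pairRow x + excessRow x)
      ≡⟨ cong (λ t → ∑[ x ] 𝟙 x * s + t) (∑-+ _ pairRow excessRow) ⟩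
    ∑[ x ] 𝟙 x * s + (∑ᵛ pairRow + excess)
      ≡⟨ cong₂ (λ u v → u + (v + excess)) (trans (∑-*ʳ _ s 𝟙) (cong (_* s) (sym s≡∑𝟙)))
                                          (trans (∑-*ˡ _ (+ 2) _) (cong (+ 2 *_) distinct-pairs)) ⟩
    s * s + (+ 2 * (s * s - s) + excess)
      ≡⟨ sym (ℤ.+-assoc (s * s) _ excess) ⟩
    s * s + + 2 * (s * s - s) + excess ∎
    where
    pairRow excessRow : F2^ n → ℤ
    pairRow x = + 2 * (∑[ y ] δᶜ y x * (𝟙 x * 𝟙 y))
    excessRow x = ∑[ y ] ∑[ z ] excessTerm x y z

  NontrivialQuadruple : F2^ n → F2^ n → F2^ n → Set
  NontrivialQuadruple x y z =
    y ≢ x × z ≢ y × z ≢ x × S x ≡ true × S y ≡ true × S z ≡ true × S (z ⊕ (x ⊕ y)) ≡ true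

  excessTerm-view : ∀ x y z → excessTerm x y z ≡ + 0 ⊎ NontrivialQuadruple x y z
  excessTerm-view x y z with y ≟ x | z ≟ y | z ≟ x | S x | S y | S z | S (z ⊕ (x ⊕ y))
  ... | yes _ | _     | _     | _     | _     | _     | _     = inj₁ refl
  ... | no _  | yes _ | _     | _     | _     | _     | _     = inj₁ refl
  ... | no _  | no _  | yes _ | _     | _     | _     | _     = inj₁ refl
  ... | no _  | no _  | no _  | false | _     | _     | _     = inj₁ refl
  ... | no _  | no _  | no _  | true  | false | _     | _     = inj₁ refl
  ... | no _  | no _  | no _  | true  | true  | false | _     = inj₁ refl
  ... | no _  | no _  | no _  | true  | true  | true  | false = inj₁ refl
  ... | no y≢x | no z≢y | no z≢x | true | true | true | true =
    inj₂ (y≢x , z≢y , z≢x , refl , refl , refl , refl)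

  excessTerm-one : ∀ {x y z} → NontrivialQuadruple x y z → excessTerm x y z ≡ + 1
  excessTerm-one {x} {y} {z} (y≢x , z≢y , z≢x , sx , sy , sz , sw)
    rewrite dec-false (y ≟ x) y≢x | dec-false (z ≟ y) z≢y | dec-false (z ≟ x) z≢x
          | sx | sy | sz | sw = refl

  excessTerm-nonneg : ∀ x y z → + 0 ≤ excessTerm x y z
  excessTerm-nonneg x y z with excessTerm-view x y z
  ... | inj₁ e≡0 = subst (+ 0 ≤_) (sym e≡0) (+≤+ ℕ.z≤n)
  ... | inj₂ nq  = subst (+ 0 ≤_) (sym (excessTerm-one nq)) (+≤+ ℕ.z≤n)

  sidon⇔noNontrivialQuadruple : IsSidon S ⇔ (∀ x y z → ¬ NontrivialQuadruple x y z)
  sidon⇔noNontrivialQuadruple = mk⇔ to from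
    where
    to : IsSidon S → ∀ x y z → ¬ NontrivialQuadruple x y z
    to sidon x y z (y≢x , z≢y , z≢x , sx , sy , sz , sw)
      with sidon x y z (z ⊕ (x ⊕ y)) sx sy sz sw (y≢x ∘ sym) z≢w (sym (⊕-involutive z (x ⊕ y)))
      where
      z≢w : z ≢ z ⊕ (x ⊕ y)
      z≢w z≡w = y≢x (sym (⊕≡0⇒≡ (begin
        x ⊕ y                  ≡⟨ sym (⊕-involutive z (x ⊕ y)) ⟩
        z ⊕ (z ⊕ (x ⊕ y))      ≡⟨ cong (z ⊕_) (sym z≡w) ⟩
        z ⊕ z                  ≡⟨ ⊕-self z ⟩
        0v n                   ∎)))
    ... | inj₁ (x≡z , _) = z≢x (sym x≡z)
    ... | inj₂ (_ , y≡z) = z≢y (sym y≡z)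
    from : (∀ x y z → ¬ NontrivialQuadruple x y z) → IsSidon S
    from none a b c d sa sb sc sd a≢b _ a⊕b≡c⊕d = decide (c ≟ a) (c ≟ b)
      where
      d≡c⊕[a⊕b] : d ≡ c ⊕ (a ⊕ b)
      d≡c⊕[a⊕b] = a⊕b≡c⊕d⇒d≡c⊕[a⊕b] a⊕b≡c⊕d
      decide : Dec (c ≡ a) → Dec (c ≡ b) → (a ≡ c × b ≡ d) ⊎ (a ≡ d × b ≡ c)
      decide (yes c≡a) _         = inj₁ (sym c≡a , sym (begin
        d                ≡⟨ d≡c⊕[a⊕b] ⟩
        c ⊕ (a ⊕ b)      ≡⟨ cong (_⊕ (a ⊕ b)) c≡a ⟩
        a ⊕ (a ⊕ b)      ≡⟨ ⊕-involutive a b ⟩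
        b                ∎))
      decide (no _)    (yes c≡b) = inj₂ (sym (begin
        d                ≡⟨ d≡c⊕[a⊕b] ⟩
        c ⊕ (a ⊕ b)      ≡⟨ cong₂ _⊕_ c≡b (⊕-comm a b) ⟩
        b ⊕ (b ⊕ a)      ≡⟨ ⊕-involutive b a ⟩
        a                ∎) , sym c≡b)
      decide (no c≢a)  (no c≢b)  = ⊥-elim (none a b c
        (a≢b ∘ sym , c≢b , c≢a , sa , sb , sc , subst (λ t → S t ≡ true) d≡c⊕[a⊕b] sd))

  excess-nonneg : + 0 ≤ excess
  excess-nonneg = ∑³-nonneg excessTerm-nonneg

  excess≡0⇔sidon : excess ≡ + 0 ⇔ IsSidon S
  excess≡0⇔sidon = ⇔.trans (mk⇔ to from) (⇔.sym sidon⇔noNontrivialQuadruple)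
    where
    to : excess ≡ + 0 → ∀ x y z → ¬ NontrivialQuadruple x y z
    to excess≡0 x y z nq
      with trans (sym (excessTerm-one nq)) (∑³-nonneg-≡0 excessTerm-nonneg excess≡0 x y z)
    ... | ()
    from : (∀ x y z → ¬ NontrivialQuadruple x y z) → excess ≡ + 0
    from none = ∑³-zero (λ x y z → [ id , ⊥-elim ∘ none x y z ]′ (excessTerm-view x y z))

  FlatSpectrum : Set
  FlatSpectrum = (a : F2^ n) → a ≢ 0v n →
    (fourier S a ≡ + 0) ⊎ (fourier S a ≡ + linearity S) ⊎ (fourier S a ≡ - (+ linearity S))

  deficit : ℤ
  deficit = ∑ (nonzeroVecs n) (λ a → flat-term (fourier S a) (linearity S))

  deficit-terms-nonneg : All (λ a → + 0 ≤ flat-term (fourier S a) (linearity S)) (nonzeroVecs n)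
  deficit-terms-nonneg =
    All.map (λ {a} → flat-term-nonneg (fourier S a) (linearity S))
            (≤-foldr-⊔ (λ a → ∣ fourier S a ∣) (nonzeroVecs n))

  deficit-nonneg : + 0 ≤ deficit
  deficit-nonneg = ∑-nonneg deficit-terms-nonneg

  deficit≡0⇔flat : deficit ≡ + 0 ⇔ FlatSpectrum
  deficit≡0⇔flat = mk⇔ to from
    where
    nonzero? : Decidable (λ (a : F2^ n) → a ≢ 0v n)
    nonzero? a = ¬? (a ≟ 0v n)
    to : deficit ≡ + 0 → FlatSpectrum
    to deficit≡0 a a≢0 = Equivalence.to (flat-term-≡0⇔ (fourier S a) (linearity S))
      (All.lookup (∑-nonneg-≡0 deficit-terms-nonneg deficit≡0) (∈-filter⁺ nonzero? (∈-allVecs a) a≢0))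
    from : FlatSpectrum → deficit ≡ + 0
    from flat = ∑-zero (All.map
      (λ {a} a≢0 → Equivalence.from (flat-term-≡0⇔ (fourier S a) (linearity S)) (flat a a≢0))
      (all-filter nonzero? (allVecs n)))

  gap : ℤ
  gap = L * L * (N - s) - (N * (+ 3 * s - + 2) - s * s * s)

  gap-identity : s * gap ≡ N * excess + deficit
  gap-identity = begin
    s * gap
      ≡⟨ expand N s L excess ⟩
    E (N * s) (N * (s * s + + 2 * (s * s - s) + excess))
      ≡⟨ cong (λ e → E (N * s) (N * e)) (sym energy-decomposition) ⟩
    E (N * s) (N * energy)
      ≡⟨ cong₂ E (sym squares) (sym fourths) ⟩
    E (s * s + P) (s * (s * s) * s + Q)
      ≡⟨ collect L s P Q (N * excess) ⟩
    N * excess + (L * L * P - Q)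
      ≡⟨ cong (λ t → N * excess + (t - Q)) (sym deficit+Q) ⟩
    N * excess + (deficit + Q - Q)
      ≡⟨ cong (λ t → N * excess + t) (cancel deficit Q) ⟩
    N * excess + deficit ∎
    where
    P Q : ℤ
    P = ∑ (nonzeroVecs n) (λ a → fourier S a * fourier S a)
    Q = ∑ (nonzeroVecs n) (λ a → fourier S a * (fourier S a * fourier S a) * fourier S a)
    -- s · gap = E (N s) (N · energy) is pure ring arithmetic; abstracting the two products
    -- lets the second and fourth moment identities be substituted for them.
    E : ℤ → ℤ → ℤ
    E u v = L * L * u - v - L * L * (s * s) + s * (s * s) * s + N * excess
    squares : s * s + P ≡ N * s
    squares = trans (∑-fourier-nonzero (λ t → t * t)) sum-of-squares
    fourths : s * (s * s) * s + Q ≡ N * energy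
    fourths = trans (∑-fourier-nonzero (λ t → t * (t * t) * t)) sum-of-fourth-powers
    deficit+Q : deficit + Q ≡ L * L * P
    deficit+Q =
      trans (sym (∑-+ _ _ _)) (trans (∑-cong _ (λ a → flat+fourth (fourier S a) L)) (∑-*ˡ _ (L * L) _))
      where
      flat+fourth : ∀ t l → t * t * (l * l - t * t) + t * (t * t) * t ≡ l * l * (t * t)
      flat+fourth = solve-∀
    expand : ∀ N s L X → s * (L * L * (N - s) - (N * (+ 3 * s - + 2) - s * s * s)) ≡
             L * L * (N * s) - N * (s * s + + 2 * (s * s - s) + X) - L * L * (s * s) + s * (s * s) * s + N * X
    expand = solve-∀
    collect : ∀ L s P Q X →
              L * L * (s * s + P) - (s * (s * s) * s + Q) - L * L * (s * s) + s * (s * s) * s + X ≡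
              X + (L * L * P - Q)
    collect = solve-∀
    cancel : ∀ d q → d + q - q ≡ d
    cancel = solve-∀

theorem3p4 : (n : ℕ) → 1 < n → (S : Subset2 n) → 0 < card S → card S < 2 ^ n →
    ((+ (2 ^ n)) * ((+ 3) * (+ card S) - (+ 2)) - (+ card S) * (+ card S) * (+ card S)
        ≤ (+ linearity S) * (+ linearity S) * ((+ (2 ^ n)) - (+ card S)))
    × (((+ (2 ^ n)) * ((+ 3) * (+ card S) - (+ 2)) - (+ card S) * (+ card S) * (+ card S)
          ≡ (+ linearity S) * (+ linearity S) * ((+ (2 ^ n)) - (+ card S)))
       ⇔ (IsSidon S × ((a : F2^ n) → a ≢ 0v n →
             (fourier S a ≡ + 0) ⊎ (fourier S a ≡ + linearity S) ⊎ (fourier S a ≡ - (+ linearity S)))))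
theorem3p4 n _ S 0<∣S∣ _ = 0≤k*[i-j]⇒j≤i 0<s 0≤s*gap , gap-vanishes⇔
  where
  open Spectrum S
  0<s : + 0 ℤ.< s
  0<s = +<+ 0<∣S∣
  0≤N*excess : + 0 ≤ N * excess
  0≤N*excess = *-nonneg {N} (+≤+ ℕ.z≤n) excess-nonneg
  0≤s*gap : + 0 ≤ s * gap
  0≤s*gap = subst (+ 0 ≤_) (sym gap-identity) (+-nonneg 0≤N*excess deficit-nonneg)
  gap-vanishes⇔ : (N * (+ 3 * s - + 2) - s * s * s ≡ L * L * (N - s)) ⇔ (IsSidon S × FlatSpectrum)
  gap-vanishes⇔ =
    ⇔.trans (j≡i⇔k*[i-j]≡0 0<s) (
    ⇔.trans (mk⇔ (trans (sym gap-identity)) (trans gap-identity)) (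
    ⇔.trans (nonneg-+-≡0⇔ 0≤N*excess deficit-nonneg)
            (⇔.trans (k*i≡0⇔i≡0 (+<+ (ℕ.m^n>0 2 n))) excess≡0⇔sidon ×-⇔ deficit≡0⇔flat)))
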